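{- Let $P$ be a finite poset. For integers $i,j$ put $b(i,j,P)=|\{B\subseteq \operatorname{Min}P\mid |B|=i,\ d(P-B)=j\}|$ and $c(j,P)=\sum_{i=0}^{m(P)}(-1)^i b(i,j,P)$. Then for all nonnegative integers $m$, $$e(m,P)=\sum_{j=1}^{d(P)} c(j,P)\, j^m,\qquad\text{with } c(d(P),P)=1.$$ In particular, $\sum_{j=1}^{d(P)}c(j,P)=e(0,P)=0$ if $P$ is nonempty, and $\sum_{j=1}^{d(P)}c(j,P)\,j=e(1,P)=1$.
   Context: For a finite poset $P$ on $K$ and a finite set $M$ disjoint from $K$ with $|M|=m$, $e(m,P)$ is the number of partial orders on $M\cup K$ inducing $P$ on $K$ whose set of minimal elements is exactly $M$. $\operatorname{Min}P$ is the set of minimal elements of $P$, $m(P)=|\operatorname{Min}P|$, $d(\cdot)$ is the number of downsets of a finite poset, and $P-B$ is the subposet induced on $K\setminus B$. Convention $j^0=1$. -}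

module Defs where

open import Data.Bool using (Bool; true; false; T; not)
open import Data.Nat using (ℕ; zero; suc; _+_)
open import Data.Integer as ℤ using (ℤ; +_; -_)
open import Data.Fin using (Fin; zero; suc; _↑ˡ_; _↑ʳ_; _≟_)
open import Data.Fin.Properties using (all?)
open import Data.Fin.Subset using (Subset; _∈_; _∉_; ∣_∣; ⊤; ∁)
open import Data.Fin.Subset.Properties using (_∈?_)
open import Data.Vec using (Vec; []; _∷_)
open import Data.Vec.Functional as VF using ()
open import Data.List using (List; []; _∷_; [_]; map; concatMap; length; filter)
open import Data.Product using (_×_; _,_)
open import Relation.Binary.PropositionalEquality using (_≡_)
open import Relation.Nullary using (Dec; ¬_)
open import Relation.Nullary.Decidable using (T?; _→-dec_; _×-dec_; ¬?)

-- Relations on Fin n, given by their (Boolean) characteristic function: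
-- R x y = true means x ≤ y.

Rel : ℕ → Set
Rel n = Fin n → Fin n → Bool

IsPartialOrder : ∀ {n} → Rel n → Set
IsPartialOrder {n} R =
  ((x : Fin n) → T (R x x)) ×
  ((x y : Fin n) → T (R x y) → T (R y x) → x ≡ y) ×
  ((x y z : Fin n) → T (R x y) → T (R y z) → T (R x z))

isPartialOrder? : ∀ {n} (R : Rel n) → Dec (IsPartialOrder R)
isPartialOrder? R =
  all? (λ x → T? (R x x)) ×-dec
  (all? λ x → all? λ y → T? (R x y) →-dec (T? (R y x) →-dec (x ≟ y))) ×-dec
  (all? λ x → all? λ y → all? λ z →
     T? (R x y) →-dec (T? (R y z) →-dec T? (R x z)))

record FinPoset (k : ℕ) : Set where
  field
    _≤P_ : Rel k
    isPO : IsPartialOrder _≤P_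
open FinPoset public

IsMinimal : ∀ {n} → Rel n → Fin n → Set
IsMinimal {n} R x = (y : Fin n) → T (R y x) → y ≡ x

isMinimal? : ∀ {n} (R : Rel n) (x : Fin n) → Dec (IsMinimal R x)
isMinimal? R x = all? λ y → T? (R y x) →-dec (y ≟ x)

count : {A : Set} {P : A → Set} → ((a : A) → Dec (P a)) → List A → ℕ
count P? xs = length (filter P? xs)

allFns : {A : Set} (n : ℕ) → List A → List (Fin n → A)
allFns zero    xs = [ (λ ()) ]
allFns (suc n) xs = concatMap (λ a → map (λ f → a VF.∷ f) (allFns n xs)) xs

allRels : (n : ℕ) → List (Rel n)
allRels n = allFns n (allFns n (true ∷ false ∷ []))

allSubsets : (n : ℕ) → List (Subset n)
allSubsets zero    = [ [] ]
allSubsets (suc n) = concatMap (λ b → map (b ∷_) (allSubsets n)) (true ∷ false ∷ [])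

MinSet : ∀ {k} → FinPoset k → Subset k
MinSet {k} P = Data.Vec.tabulate (λ x → Relation.Nullary.Decidable.does (isMinimal? (_≤P_ P) x))
  where import Data.Vec; import Relation.Nullary.Decidable

mP : ∀ {k} → FinPoset k → ℕ
mP P = ∣ MinSet P ∣

IsDownsetOn : ∀ {k} → FinPoset k → Subset k → Subset k → Set
IsDownsetOn {k} P S D =
  ((x : Fin k) → x ∈ D → x ∈ S) ×
  ((x y : Fin k) → x ∈ S → y ∈ D → T (_≤P_ P x y) → x ∈ D)

isDownsetOn? : ∀ {k} (P : FinPoset k) (S D : Subset k) → Dec (IsDownsetOn P S D)
isDownsetOn? P S D =
  (all? λ x → (x ∈? D) →-dec (x ∈? S)) ×-dec
  (all? λ x → all? λ y → (x ∈? S) →-dec ((y ∈? D) →-dec (T? (_≤P_ P x y) →-dec (x ∈? D))))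

dOn : ∀ {k} → FinPoset k → Subset k → ℕ
dOn {k} P S = count (isDownsetOn? P S) (allSubsets k)

d : ∀ {k} → FinPoset k → ℕ
d P = dOn P ⊤

dMinus : ∀ {k} → FinPoset k → Subset k → ℕ
dMinus P B = dOn P (∁ B)

-- e(m,P): M = Fin m (embedded as i ↑ˡ k), K = Fin k (embedded as m ↑ʳ x)
-- in the ground set Fin (m + k) ≅ M ⊎ K.

IsExtension : (m : ℕ) {k : ℕ} → FinPoset k → Rel (m + k) → Set
IsExtension m {k} P Q =
  IsPartialOrder Q ×
  ((x y : Fin k) → Q (m ↑ʳ x) (m ↑ʳ y) ≡ _≤P_ P x y) ×
  ((i : Fin m) → IsMinimal Q (i ↑ˡ k)) ×
  ((x : Fin k) → ¬ IsMinimal Q (m ↑ʳ x))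

isExtension? : (m : ℕ) {k : ℕ} (P : FinPoset k) (Q : Rel (m + k)) → Dec (IsExtension m P Q)
isExtension? m {k} P Q =
  isPartialOrder? Q ×-dec
  (all? λ x → all? λ y → Q (m ↑ʳ x) (m ↑ʳ y) Data.Bool.≟ _≤P_ P x y) ×-dec
  (all? λ i → isMinimal? Q (i ↑ˡ k)) ×-dec
  (all? λ x → ¬? (isMinimal? Q (m ↑ʳ x)))
  where import Data.Bool

e : (m : ℕ) {k : ℕ} → FinPoset k → ℕ
e m {k} P = count (isExtension? m P) (allRels (m + k))

IsBSet : ∀ {k} → FinPoset k → ℕ → ℕ → Subset k → Set
IsBSet {k} P i j B =
  ((x : Fin k) → x ∈ B → x ∈ MinSet P) × (∣ B ∣ ≡ i) × (dMinus P B ≡ j)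

isBSet? : ∀ {k} (P : FinPoset k) (i j : ℕ) (B : Subset k) → Dec (IsBSet P i j B)
isBSet? P i j B =
  (all? λ x → (x ∈? B) →-dec (x ∈? MinSet P)) ×-dec
  (∣ B ∣ Data.Nat.≟ i) ×-dec (dMinus P B Data.Nat.≟ j)
  where import Data.Nat

b : ℕ → ℕ → ∀ {k} → FinPoset k → ℕ
b i j {k} P = count (isBSet? P i j) (allSubsets k)

sum0to : ℕ → (ℕ → ℤ) → ℤ
sum0to zero    f = f zero
sum0to (suc n) f = sum0to n f ℤ.+ f (suc n)

sum1to : ℕ → (ℕ → ℤ) → ℤ
sum1to zero    f = + 0
sum1to (suc n) f = sum1to n f ℤ.+ f (suc n)

sgn : ℕ → ℤ
sgn i = (- (+ 1)) ℤ.^ i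

c : ℕ → ∀ {k} → FinPoset k → ℤ
c j P = sum0to (mP P) (λ i → sgn i ℤ.* (+ b i j P))

-- In an extension Q of P by m new minimal elements, the new elements form an antichain, no old
-- element lies below a new one, and a new element a is determined by the up-set Uₐ of old elements
-- above it; Q is an extension exactly when every minimal element of P lies in some Uₐ.
-- Inclusion–exclusion over the set B of minimal elements lying in no Uₐ gives
--   e(m,P) = Σ_{B ⊆ Min P} (-1)^|B| u(B)ᵐ,   u(B) = number of up-sets avoiding B.
-- Complementation inside K ∖ B turns these up-sets into the down-sets of P - B, so u(B) = d(P - B),
-- and grouping the terms by j = d(P - B) produces the c(j,P). Only B = ∅ reaches j = d(P), hence
-- c(d(P),P) = 1. For m = 0 and m = 1 the formula collapses by inclusion–exclusion once more, because
-- a nonempty finite poset has a minimal element and the only up-set containing Min P is everything.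

module Submission where

open import Defs
open import Data.Nat using (ℕ; _<_)
open import Data.Integer using (ℤ; +_; _*_; _^_)
open import Data.Product using (_×_)
open import Relation.Binary.PropositionalEquality using (_≡_)

open import Data.Bool as Bool using (Bool; true; false; T)
open import Data.Empty using (⊥-elim)
open import Data.Fin using (Fin; zero; suc; _↑ˡ_; _↑ʳ_; _≟_; fromℕ<)
open import Data.Fin.Induction using (po-wellFounded)
open import Data.Fin.Properties as Fin using (all?; ¬∀⟶∃¬)
open import Data.Fin.Subset using (Subset; _∈_; _∉_; _⊆_; ∣_∣; ∁; _─_; ⊥; ⊤; Empty)
open import Data.Fin.Subset.Properties
  using ( _∈?_; _⊆?_; nonempty?; drop-∷-⊆; out⊆; in⊆in; drop-∷-Empty; Empty-unique
        ; p─q⊆p; x∈∁p⇒x∉p; x∉p⇒x∈∁p; x∈p∧x∉q⇒x∈p─q; ∈⊤; ∉⊥; ⊥⊆; ⊆⊤; ⊆-antisym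
        ; p⊆q⇒∣p∣≤∣q∣; ∣⊥∣≡0 )
open import Data.Integer using (_+_; -_)
import Data.Integer.Properties as ℤ
open import Data.Integer.Tactic.RingSolver using (solve-∀)
open import Data.List using (List; []; _∷_; _++_; map; concatMap)
open import Data.List.Membership.Propositional using () renaming (_∈_ to _∈ₗ_)
open import Data.List.Membership.Propositional.Properties
  using () renaming (∈-++⁺ˡ to ∈ₗ-++⁺ˡ; ∈-++⁺ʳ to ∈ₗ-++⁺ʳ; ∈-map⁺ to ∈ₗ-map⁺)
import Data.List.Properties as List
open import Data.List.Relation.Unary.Any using (here; there)
import Data.Nat as ℕ
import Data.Nat.Properties as ℕ
open import Data.Product using (_,_; proj₁; proj₂; ∃-syntax)
open import Data.Sum using (inj₁; inj₂)
open import Data.Vec using ([]; _∷_; tabulate; here; there)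
import Data.Vec.Functional as VF
import Data.Vec.Properties as Vec
open import Function using (_∘_; id; const; case_of_; _⇔_; mk⇔; Equivalence)
open import Induction.WellFounded using (Acc; acc)
open import Level using (0ℓ)
import Relation.Binary.Construct.NonStrictToStrict as ToStrict
open import Relation.Binary.PropositionalEquality
  using (_≢_; refl; isEquivalence; sym; trans; cong; cong₂; subst; module ≡-Reasoning)
open import Relation.Binary.Structures using () renaming (IsPartialOrder to IsPartialOrder′)
open import Relation.Nullary using (Dec; yes; no; ¬_; does)
open import Relation.Nullary.Decidable using (T?; _×-dec_; _→-dec_; ¬?; dec-true)
open import Relation.Unary using (Pred; Decidable)

ind : {A : Set} → Dec A → ℤ
ind (yes _) = + 1
ind (no _)  = + 0

ind-yes : {A : Set} → A → (a? : Dec A) → ind a? ≡ + 1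
ind-yes a (yes _) = refl
ind-yes a (no ¬a) = ⊥-elim (¬a a)

ind-no : {A : Set} → ¬ A → (a? : Dec A) → ind a? ≡ + 0
ind-no ¬a (yes a) = ⊥-elim (¬a a)
ind-no ¬a (no _)  = refl

ind-cong : {A B : Set} → (A → B) → (B → A) → (a? : Dec A) (b? : Dec B) → ind a? ≡ ind b?
ind-cong f g (yes a) b? = sym (ind-yes (f a) b?)
ind-cong f g (no ¬a) b? = sym (ind-no (¬a ∘ g) b?)

ind-× : {A B C : Set} → (C → A × B) → (A × B → C) →
        (a? : Dec A) (b? : Dec B) (c? : Dec C) → ind c? ≡ ind a? * ind b?
ind-× f g (yes a) (yes b) c? = ind-yes (g (a , b)) c?
ind-× f g (yes a) (no ¬b) c? = ind-no (¬b ∘ proj₂ ∘ f) c?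
ind-× f g (no ¬a) b?      c? = ind-no (¬a ∘ proj₁ ∘ f) c?

ind-×-⇔ : {A B C D : Set} → (A × B) ⇔ (C × D) →
          (a? : Dec A) (b? : Dec B) (c? : Dec C) (d? : Dec D) → ind a? * ind b? ≡ ind c? * ind d?
ind-×-⇔ A×B⇔C×D a? b? c? d? =
  trans (sym (ind-× id id a? b? (a? ×-dec b?)))
        (trans (ind-cong (Equivalence.to A×B⇔C×D) (Equivalence.from A×B⇔C×D) (a? ×-dec b?) (c? ×-dec d?))
               (ind-× id id c? d? (c? ×-dec d?)))

∑ : {A : Set} → List A → (A → ℤ) → ℤ
∑ []       f = + 0
∑ (x ∷ xs) f = f x + ∑ xs f

module _ {A : Set} where

  ∑-cong : (xs : List A) {f g : A → ℤ} → (∀ x → f x ≡ g x) → ∑ xs f ≡ ∑ xs g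
  ∑-cong []       eq = refl
  ∑-cong (x ∷ xs) eq = cong₂ _+_ (eq x) (∑-cong xs eq)

  ∑-zero : (xs : List A) {f : A → ℤ} → (∀ x → f x ≡ + 0) → ∑ xs f ≡ + 0
  ∑-zero []       eq = refl
  ∑-zero (x ∷ xs) eq = cong₂ _+_ (eq x) (∑-zero xs eq)

  ∑-++ : (xs ys : List A) (f : A → ℤ) → ∑ (xs ++ ys) f ≡ ∑ xs f + ∑ ys f
  ∑-++ []       ys f = sym (ℤ.+-identityˡ _)
  ∑-++ (x ∷ xs) ys f = trans (cong (_+_ (f x)) (∑-++ xs ys f)) (sym (ℤ.+-assoc (f x) _ _))

  ∑-map : {B : Set} (h : B → A) (xs : List B) (f : A → ℤ) → ∑ (map h xs) f ≡ ∑ xs (f ∘ h)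
  ∑-map h []       f = refl
  ∑-map h (x ∷ xs) f = cong (_+_ (f (h x))) (∑-map h xs f)

  ∑-concatMap : {B : Set} (h : B → List A) (xs : List B) (f : A → ℤ) →
                ∑ (concatMap h xs) f ≡ ∑ xs (λ x → ∑ (h x) f)
  ∑-concatMap h []       f = refl
  ∑-concatMap h (x ∷ xs) f =
    trans (∑-++ (h x) (concatMap h xs) f) (cong (_+_ (∑ (h x) f)) (∑-concatMap h xs f))

  ∑-+ : (xs : List A) (f g : A → ℤ) → ∑ xs (λ x → f x + g x) ≡ ∑ xs f + ∑ xs g
  ∑-+ []       f g = refl
  ∑-+ (x ∷ xs) f g = trans (cong (_+_ (f x + g x)) (∑-+ xs f g)) (interchange (f x) (g x) _ _)
    where
    interchange : ∀ a b c d → a + b + (c + d) ≡ a + c + (b + d)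
    interchange = solve-∀

  ∑-*ˡ : (xs : List A) (c : ℤ) (f : A → ℤ) → ∑ xs (λ x → c * f x) ≡ c * ∑ xs f
  ∑-*ˡ []       c f = sym (ℤ.*-zeroʳ c)
  ∑-*ˡ (x ∷ xs) c f =
    trans (cong (_+_ (c * f x)) (∑-*ˡ xs c f)) (sym (ℤ.*-distribˡ-+ c (f x) _))

  ∑-*ʳ : (xs : List A) (c : ℤ) (f : A → ℤ) → ∑ xs (λ x → f x * c) ≡ ∑ xs f * c
  ∑-*ʳ xs c f = trans (∑-cong xs (λ x → ℤ.*-comm (f x) c)) (trans (∑-*ˡ xs c f) (ℤ.*-comm c _))

∑-comm : {A B : Set} (xs : List A) (ys : List B) (f : A → B → ℤ) →
         ∑ xs (λ x → ∑ ys (f x)) ≡ ∑ ys (λ y → ∑ xs (λ x → f x y))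
∑-comm []       ys f = sym (∑-zero ys (λ _ → refl))
∑-comm (x ∷ xs) ys f = trans (cong (_+_ (∑ ys (f x))) (∑-comm xs ys f)) (sym (∑-+ ys (f x) _))

count≡∑ind : {A : Set} {P : Pred A 0ℓ} (P? : Decidable P) (xs : List A) →
             + count P? xs ≡ ∑ xs (λ x → ind (P? x))
count≡∑ind P? [] = refl
count≡∑ind P? (x ∷ xs) with P? x
... | yes _ = cong (_+_ (+ 1)) (count≡∑ind P? xs)
... | no  _ = trans (count≡∑ind P? xs) (sym (ℤ.+-identityˡ _))

count-none : {A : Set} {P : Pred A 0ℓ} (P? : Decidable P) → (∀ {x} → ¬ P x) →
             (xs : List A) → count P? xs ≡ 0
count-none P? ¬p xs = ℤ.+-injective (trans (count≡∑ind P? xs) (∑-zero xs (λ x → ind-no ¬p (P? x))))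

ind-guard : {A : Set} (a? : Dec A) {x y : ℤ} → (A → x ≡ y) → ind a? * x ≡ ind a? * y
ind-guard (yes a) x≡y = cong (+ 1 *_) (x≡y a)
ind-guard (no _)  _   = refl

sum0to-cong : ∀ n {f g : ℕ → ℤ} → (∀ i → f i ≡ g i) → sum0to n f ≡ sum0to n g
sum0to-cong ℕ.zero    eq = eq 0
sum0to-cong (ℕ.suc n) eq = cong₂ _+_ (sum0to-cong n eq) (eq (ℕ.suc n))

sum1to-cong : ∀ n {f g : ℕ → ℤ} → (∀ i → f i ≡ g i) → sum1to n f ≡ sum1to n g
sum1to-cong ℕ.zero    eq = refl
sum1to-cong (ℕ.suc n) eq = cong₂ _+_ (sum1to-cong n eq) (eq (ℕ.suc n))

sum0to-∑ : {A : Set} (n : ℕ) (xs : List A) (f : ℕ → A → ℤ) →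
           sum0to n (λ i → ∑ xs (f i)) ≡ ∑ xs (λ x → sum0to n (λ i → f i x))
sum0to-∑ ℕ.zero    xs f = refl
sum0to-∑ (ℕ.suc n) xs f = trans (cong (_+ ∑ xs (f (ℕ.suc n))) (sum0to-∑ n xs f)) (sym (∑-+ xs _ _))

sum1to-∑ : {A : Set} (n : ℕ) (xs : List A) (f : ℕ → A → ℤ) →
           sum1to n (λ i → ∑ xs (f i)) ≡ ∑ xs (λ x → sum1to n (λ i → f i x))
sum1to-∑ ℕ.zero    xs f = sym (∑-zero xs (λ _ → refl))
sum1to-∑ (ℕ.suc n) xs f = trans (cong (_+ ∑ xs (f (ℕ.suc n))) (sum1to-∑ n xs f)) (sym (∑-+ xs _ _))

sum0to-*ˡ : ∀ n c (f : ℕ → ℤ) → sum0to n (λ i → c * f i) ≡ c * sum0to n f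
sum0to-*ˡ ℕ.zero    c f = refl
sum0to-*ˡ (ℕ.suc n) c f = trans (cong (_+ c * f (ℕ.suc n)) (sum0to-*ˡ n c f)) (sym (ℤ.*-distribˡ-+ c _ _))

sum1to-*ˡ : ∀ n c (f : ℕ → ℤ) → sum1to n (λ i → c * f i) ≡ c * sum1to n f
sum1to-*ˡ ℕ.zero    c f = sym (ℤ.*-zeroʳ c)
sum1to-*ˡ (ℕ.suc n) c f = trans (cong (_+ c * f (ℕ.suc n)) (sum1to-*ˡ n c f)) (sym (ℤ.*-distribˡ-+ c _ _))

module _ (a : ℕ) (f : ℕ → ℤ) where

  private
    term : ℕ → ℤ
    term i = ind (a ℕ.≟ i) * f i

    term-≢ : ∀ {i} → a ≢ i → term i ≡ + 0
    term-≢ {i} a≢i = cong (_* f i) (ind-no a≢i (a ℕ.≟ i))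

    term-≡ : term a ≡ f a
    term-≡ = trans (cong (_* f a) (ind-yes refl (a ℕ.≟ a))) (ℤ.*-identityˡ (f a))

  sum0to-δ-out : ∀ n → n < a → sum0to n (λ i → ind (a ℕ.≟ i) * f i) ≡ + 0
  sum0to-δ-out ℕ.zero    n<a = term-≢ (ℕ.>⇒≢ n<a)
  sum0to-δ-out (ℕ.suc n) n<a =
    cong₂ _+_ (sum0to-δ-out n (ℕ.<-trans (ℕ.n<1+n n) n<a)) (term-≢ (ℕ.>⇒≢ n<a))

  sum0to-δ : ∀ n → a ℕ.≤ n → sum0to n (λ i → ind (a ℕ.≟ i) * f i) ≡ f a
  sum0to-δ n a≤n with ℕ.m≤n⇒m<n∨m≡n a≤n
  sum0to-δ ℕ.zero      a≤n | inj₂ refl = term-≡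
  sum0to-δ (ℕ.suc n)   a≤n | inj₂ refl =
    trans (cong (_+ term a) (sum0to-δ-out n (ℕ.n<1+n n))) (trans (ℤ.+-identityˡ _) term-≡)
  sum0to-δ (ℕ.suc n)   a≤n | inj₁ a<1+n =
    trans (cong₂ _+_ (sum0to-δ n (ℕ.≤-pred a<1+n)) (term-≢ (ℕ.<⇒≢ a<1+n))) (ℤ.+-identityʳ _)

  sum1to-δ-out : ∀ n → n < a → sum1to n (λ i → ind (a ℕ.≟ i) * f i) ≡ + 0
  sum1to-δ-out ℕ.zero    n<a = refl
  sum1to-δ-out (ℕ.suc n) n<a =
    cong₂ _+_ (sum1to-δ-out n (ℕ.<-trans (ℕ.n<1+n n) n<a)) (term-≢ (ℕ.>⇒≢ n<a))

  sum1to-δ : ∀ n → 0 < a → a ℕ.≤ n → sum1to n (λ i → ind (a ℕ.≟ i) * f i) ≡ f a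
  sum1to-δ n 0<a a≤n with ℕ.m≤n⇒m<n∨m≡n a≤n
  sum1to-δ ℕ.zero      0<a a≤n | inj₂ refl = ⊥-elim (ℕ.<-irrefl refl 0<a)
  sum1to-δ (ℕ.suc n)   0<a a≤n | inj₂ refl =
    trans (cong (_+ term a) (sum1to-δ-out n (ℕ.n<1+n n))) (trans (ℤ.+-identityˡ _) term-≡)
  sum1to-δ (ℕ.suc n)   0<a a≤n | inj₁ a<1+n =
    trans (cong₂ _+_ (sum1to-δ n 0<a (ℕ.≤-pred a<1+n)) (term-≢ (ℕ.<⇒≢ a<1+n))) (ℤ.+-identityʳ _)

Bools : List Bool
Bools = true ∷ false ∷ []

∑-allFns-suc : {X : Set} (n : ℕ) (xs : List X) (F : (Fin (ℕ.suc n) → X) → ℤ) →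
               ∑ (allFns (ℕ.suc n) xs) F ≡ ∑ xs (λ a → ∑ (allFns n xs) (λ f → F (a VF.∷ f)))
∑-allFns-suc n xs F =
  trans (∑-concatMap (λ a → map (a VF.∷_) (allFns n xs)) xs F)
        (∑-cong xs (λ a → ∑-map (a VF.∷_) (allFns n xs) F))

∑-allSubsets-suc : (k : ℕ) (F : Subset (ℕ.suc k) → ℤ) →
  ∑ (allSubsets (ℕ.suc k)) F ≡ ∑ (allSubsets k) (F ∘ (true ∷_)) + ∑ (allSubsets k) (F ∘ (false ∷_))
∑-allSubsets-suc k F = trans (∑-concatMap (λ b → map (b ∷_) (allSubsets k)) Bools F)
  (cong₂ _+_ (∑-map (true ∷_) (allSubsets k) F)
             (trans (ℤ.+-identityʳ _) (∑-map (false ∷_) (allSubsets k) F)))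

map-tabulate-allFns : (k : ℕ) → map tabulate (allFns k Bools) ≡ allSubsets k
map-tabulate-allFns ℕ.zero    = refl
map-tabulate-allFns (ℕ.suc k) =
  trans (List.map-++ tabulate (map (true VF.∷_) (allFns k Bools)) _)
        (cong₂ _++_ (prepend true)
               (trans (List.map-++ tabulate (map (false VF.∷_) (allFns k Bools)) [])
                      (cong (_++ []) (prepend false))))
  where
  prepend : ∀ b → map tabulate (map (b VF.∷_) (allFns k Bools)) ≡ map (b ∷_) (allSubsets k)
  prepend b = begin
    map tabulate (map (b VF.∷_) (allFns k Bools)) ≡⟨ sym (List.map-∘ (allFns k Bools)) ⟩
    map ((b ∷_) ∘ tabulate) (allFns k Bools)       ≡⟨ List.map-∘ (allFns k Bools) ⟩
    map (b ∷_) (map tabulate (allFns k Bools))     ≡⟨ cong (map (b ∷_)) (map-tabulate-allFns k) ⟩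
    map (b ∷_) (allSubsets k)                       ∎
    where open ≡-Reasoning

∑-allFns-Bools : (k : ℕ) (F : Subset k → ℤ) →
                 ∑ (allFns k Bools) (F ∘ tabulate) ≡ ∑ (allSubsets k) F
∑-allFns-Bools k F = trans (sym (∑-map tabulate (allFns k Bools) F))
                           (cong (λ vs → ∑ vs F) (map-tabulate-allFns k))

∑-allFns-∀ : {X : Set} (n : ℕ) (xs : List X) {G : Fin n → X → Set} (G? : ∀ i x → Dec (G i x))
  (D? : (f : Fin n → X) → Dec (∀ i → G i (f i))) {c : ℤ} →
  (∀ i → ∑ xs (λ x → ind (G? i x)) ≡ c) → ∑ (allFns n xs) (λ f → ind (D? f)) ≡ c ^ n
∑-allFns-∀ ℕ.zero    xs G? D? _   = cong (_+ + 0) (ind-yes (λ ()) (D? _))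
∑-allFns-∀ (ℕ.suc n) xs {G} G? D? {c} per-index = begin
  ∑ (allFns (ℕ.suc n) xs) (λ f → ind (D? f))
    ≡⟨ ∑-allFns-suc n xs _ ⟩
  ∑ xs (λ a → ∑ (allFns n xs) (λ f → ind (D? (a VF.∷ f))))
    ≡⟨ ∑-cong xs (λ a → trans (∑-cong (allFns n xs) (split a))
                              (∑-*ˡ (allFns n xs) (ind (G? zero a)) _)) ⟩
  ∑ xs (λ a → ind (G? zero a) * ∑ (allFns n xs) (λ f → ind (D′? f)))
    ≡⟨ ∑-*ʳ xs _ _ ⟩
  ∑ xs (λ a → ind (G? zero a)) * ∑ (allFns n xs) (λ f → ind (D′? f))
    ≡⟨ cong₂ _*_ (per-index zero) (∑-allFns-∀ n xs (G? ∘ suc) D′? (per-index ∘ suc)) ⟩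
  c * c ^ n ∎
  where
  open ≡-Reasoning
  D′? : (f : Fin n → _) → Dec (∀ i → G (suc i) (f i))
  D′? f = all? (λ i → G? (suc i) (f i))
  split : ∀ a f → ind (D? (a VF.∷ f)) ≡ ind (G? zero a) * ind (D′? f)
  split a f = ind-× (λ h → h zero , h ∘ suc) (λ { (g , h) zero → g ; (g , h) (suc i) → h i })
                    (G? zero a) (D′? f) (D? (a VF.∷ f))

∑-allFns-split : {X : Set} (m k : ℕ) (xs : List X)
  {G : Fin m → X → Set} (G? : ∀ a x → Dec (G a x)) {R : (Fin k → X) → Set} (R? : ∀ g → Dec (R g))
  (D? : (f : Fin (m ℕ.+ k) → X) → Dec ((∀ a → G a (f (a ↑ˡ k))) × R (f ∘ (m ↑ʳ_)))) {c : ℤ} →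
  (∀ a → ∑ xs (λ x → ind (G? a x)) ≡ c) →
  ∑ (allFns (m ℕ.+ k) xs) (λ f → ind (D? f)) ≡ c ^ m * ∑ (allFns k xs) (λ g → ind (R? g))
∑-allFns-split ℕ.zero k xs G? R? D? _ = trans
  (∑-cong (allFns k xs) (λ f → ind-cong proj₂ ((λ ()) ,_) (D? f) (R? f)))
  (sym (ℤ.*-identityˡ _))
∑-allFns-split (ℕ.suc m) k xs {G} G? {R} R? D? {c} per-index = begin
  ∑ (allFns (ℕ.suc m ℕ.+ k) xs) (λ f → ind (D? f))
    ≡⟨ ∑-allFns-suc (m ℕ.+ k) xs _ ⟩
  ∑ xs (λ a → ∑ (allFns (m ℕ.+ k) xs) (λ f → ind (D? (a VF.∷ f))))
    ≡⟨ ∑-cong xs (λ a → trans (∑-cong (allFns (m ℕ.+ k) xs) (λ f → split a f))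
                              (∑-*ˡ (allFns (m ℕ.+ k) xs) (ind (G? zero a)) _)) ⟩
  ∑ xs (λ a → ind (G? zero a) * ∑ (allFns (m ℕ.+ k) xs) (λ f → ind (D′? f)))
    ≡⟨ ∑-*ʳ xs _ _ ⟩
  ∑ xs (λ a → ind (G? zero a)) * ∑ (allFns (m ℕ.+ k) xs) (λ f → ind (D′? f))
    ≡⟨ cong₂ _*_ (per-index zero) (∑-allFns-split m k xs (G? ∘ suc) R? D′? (per-index ∘ suc)) ⟩
  c * (c ^ m * ∑ (allFns k xs) (λ g → ind (R? g)))
    ≡⟨ sym (ℤ.*-assoc c _ _) ⟩
  c ^ ℕ.suc m * ∑ (allFns k xs) (λ g → ind (R? g)) ∎
  where
  open ≡-Reasoning
  D′? : (f : Fin (m ℕ.+ k) → _) → Dec ((∀ a → G (suc a) (f (a ↑ˡ k))) × R (f ∘ (m ↑ʳ_)))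
  D′? f = all? (λ a → G? (suc a) (f (a ↑ˡ k))) ×-dec R? (f ∘ (m ↑ʳ_))
  split : ∀ a f → ind (D? (a VF.∷ f)) ≡ ind (G? zero a) * ind (D′? f)
  split a f = ind-× (λ (h , r) → h zero , (h ∘ suc) , r)
                    (λ { (g , h , r) → (λ { zero → g ; (suc i) → h i }) , r })
                    (G? zero a) (D′? f) (D? (a VF.∷ f))

∑-allSubsets-only : {k : ℕ} (w : Subset k) (F : Subset k → ℤ) →
                    (∀ v → v ≢ w → F v ≡ + 0) → ∑ (allSubsets k) F ≡ F w
∑-allSubsets-only [] F _ = ℤ.+-identityʳ (F [])
∑-allSubsets-only {ℕ.suc k} (true ∷ w) F vanish = begin
  ∑ (allSubsets (ℕ.suc k)) F
    ≡⟨ ∑-allSubsets-suc k F ⟩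
  ∑ (allSubsets k) (F ∘ (true ∷_)) + ∑ (allSubsets k) (F ∘ (false ∷_))
    ≡⟨ cong₂ _+_ (∑-allSubsets-only w (F ∘ (true ∷_)) (λ v v≢w → vanish _ (v≢w ∘ Vec.∷-injectiveʳ)))
                 (∑-zero (allSubsets k) (λ v → vanish _ (λ ()))) ⟩
  F (true ∷ w) + + 0
    ≡⟨ ℤ.+-identityʳ _ ⟩
  F (true ∷ w) ∎
  where open ≡-Reasoning
∑-allSubsets-only {ℕ.suc k} (false ∷ w) F vanish = begin
  ∑ (allSubsets (ℕ.suc k)) F
    ≡⟨ ∑-allSubsets-suc k F ⟩
  ∑ (allSubsets k) (F ∘ (true ∷_)) + ∑ (allSubsets k) (F ∘ (false ∷_))
    ≡⟨ cong₂ _+_ (∑-zero (allSubsets k) (λ v → vanish _ (λ ())))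
                 (∑-allSubsets-only w (F ∘ (false ∷_)) (λ v v≢w → vanish _ (v≢w ∘ Vec.∷-injectiveʳ))) ⟩
  + 0 + F (false ∷ w)
    ≡⟨ ℤ.+-identityˡ _ ⟩
  F (false ∷ w) ∎
  where open ≡-Reasoning

count-allSubsets-suc : {k : ℕ} {P : Pred (Subset (ℕ.suc k)) 0ℓ} (P? : Decidable P) →
  count P? (allSubsets (ℕ.suc k))
    ≡ count (P? ∘ (true ∷_)) (allSubsets k) ℕ.+ count (P? ∘ (false ∷_)) (allSubsets k)
count-allSubsets-suc {k} P? = ℤ.+-injective (begin
  + count P? (allSubsets (ℕ.suc k))
    ≡⟨ count≡∑ind P? (allSubsets (ℕ.suc k)) ⟩
  ∑ (allSubsets (ℕ.suc k)) (λ v → ind (P? v))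
    ≡⟨ ∑-allSubsets-suc k _ ⟩
  ∑ (allSubsets k) (λ v → ind (P? (true ∷ v))) + ∑ (allSubsets k) (λ v → ind (P? (false ∷ v)))
    ≡⟨ cong₂ _+_ (count≡∑ind (P? ∘ (true ∷_)) (allSubsets k))
                 (count≡∑ind (P? ∘ (false ∷_)) (allSubsets k)) ⟨
  + count (P? ∘ (true ∷_)) (allSubsets k) + + count (P? ∘ (false ∷_)) (allSubsets k) ∎)
  where open ≡-Reasoning

∈-allSubsets : {k : ℕ} (v : Subset k) → v ∈ₗ allSubsets k
∈-allSubsets []          = here refl
∈-allSubsets (true ∷ v)  = ∈ₗ-++⁺ˡ (∈ₗ-map⁺ (true ∷_) (∈-allSubsets v))
∈-allSubsets {ℕ.suc k} (false ∷ v) =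
  ∈ₗ-++⁺ʳ (map (true ∷_) (allSubsets k)) (∈ₗ-++⁺ˡ (∈ₗ-map⁺ (false ∷_) (∈-allSubsets v)))

∁⊥≡⊤ : (k : ℕ) → ∁ (⊥ {k}) ≡ ⊤
∁⊥≡⊤ ℕ.zero    = refl
∁⊥≡⊤ (ℕ.suc k) = cong (true ∷_) (∁⊥≡⊤ k)

x∈p─q⇒x∉q : {k : ℕ} {p q : Subset k} {x : Fin k} → x ∈ p ─ q → x ∉ q
x∈p─q⇒x∉q {p = true ∷ p} {false ∷ q} here       ()
x∈p─q⇒x∉q {p = s ∷ p}    {t ∷ q}     (there x∈) (there x∈q) = x∈p─q⇒x∉q x∈ x∈q

∈∁─⁻ : {k : ℕ} {B v : Subset k} {x : Fin k} → x ∈ ∁ B ─ v → x ∉ B × x ∉ v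
∈∁─⁻ {B = B} {v} x∈ = x∈∁p⇒x∉p (p─q⊆p (∁ B) v x∈) , x∈p─q⇒x∉q x∈

∈∁─⁺ : {k : ℕ} {B v : Subset k} {x : Fin k} → x ∉ B → x ∉ v → x ∈ ∁ B ─ v
∈∁─⁺ x∉B x∉v = x∈p∧x∉q⇒x∈p─q (x∉p⇒x∈∁p x∉B) x∉v


T⇒≡true : ∀ {b} → T b → b ≡ true
T⇒≡true {true} _ = refl

≡true⇒T : ∀ {b} → b ≡ true → T b
≡true⇒T refl = _

¬T⇒≡false : ∀ {b} → ¬ T b → b ≡ false
¬T⇒≡false {false} _  = refl
¬T⇒≡false {true}  ¬t = ⊥-elim (¬t _)

∈-tabulate⁻ : {k : ℕ} {f : Fin k → Bool} {x : Fin k} → x ∈ tabulate f → f x ≡ true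
∈-tabulate⁻ {f = f} {x} x∈ = trans (sym (Vec.lookup∘tabulate f x)) (Vec.[]=⇒lookup x∈)

∈-tabulate⁺ : {k : ℕ} {f : Fin k → Bool} {x : Fin k} → f x ≡ true → x ∈ tabulate f
∈-tabulate⁺ {f = f} {x} fx = Vec.lookup⇒[]= x _ (trans (Vec.lookup∘tabulate f x) fx)

∈-tabulate⁻-T : {k : ℕ} {f : Fin k → Bool} {x : Fin k} → x ∈ tabulate f → T (f x)
∈-tabulate⁻-T = ≡true⇒T ∘ ∈-tabulate⁻

∈-tabulate⁺-T : {k : ℕ} {f : Fin k → Bool} {x : Fin k} → T (f x) → x ∈ tabulate f
∈-tabulate⁺-T = ∈-tabulate⁺ ∘ T⇒≡true

∈-tabulate-does⁻ : {k : ℕ} {P : Pred (Fin k) 0ℓ} (P? : Decidable P) {x : Fin k} →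
                   x ∈ tabulate (λ y → does (P? y)) → P x
∈-tabulate-does⁻ P? {x} x∈ with P? x | ∈-tabulate⁻ x∈
... | yes p | _ = p

∈-tabulate-does⁺ : {k : ℕ} {P : Pred (Fin k) 0ℓ} (P? : Decidable P) {x : Fin k} →
                   P x → x ∈ tabulate (λ y → does (P? y))
∈-tabulate-does⁺ P? {x} = ∈-tabulate⁺ ∘ dec-true (P? x)

empty? : {k : ℕ} (S : Subset k) → Dec (Empty S)
empty? S = ¬? (nonempty? S)

inclusion–exclusion : {k : ℕ} (S : Subset k) →
  ∑ (allSubsets k) (λ B → ind (B ⊆? S) * sgn ∣ B ∣) ≡ ind (empty? S)
inclusion–exclusion [] = cong (λ z → z * + 1 + + 0) (ind-yes (λ ()) ([] ⊆? []))
inclusion–exclusion {ℕ.suc k} (true ∷ S) = begin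
  ∑ (allSubsets (ℕ.suc k)) (λ B → ind (B ⊆? true ∷ S) * sgn ∣ B ∣)
    ≡⟨ ∑-allSubsets-suc k (λ B → ind (B ⊆? true ∷ S) * sgn ∣ B ∣) ⟩
  ∑ (allSubsets k) (λ v → ind (true ∷ v ⊆? true ∷ S) * sgn (ℕ.suc ∣ v ∣)) +
  ∑ (allSubsets k) (λ v → ind (false ∷ v ⊆? true ∷ S) * sgn ∣ v ∣)
    ≡⟨ cong₂ _+_ (trans (∑-cong (allSubsets k) (λ v → negate (ind-drop-inside v) (sgn ∣ v ∣)))
                        (∑-*ˡ (allSubsets k) (- + 1) _))
                 (∑-cong (allSubsets k) (λ v → cong (_* sgn ∣ v ∣) (ind-drop-outside v))) ⟩
  - + 1 * X + X
    ≡⟨ cancel X ⟩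
  + 0
    ≡⟨ ind-no (λ empty → empty (zero , here)) (empty? (true ∷ S)) ⟨
  ind (empty? (true ∷ S)) ∎
  where
  open ≡-Reasoning
  X = ∑ (allSubsets k) (λ v → ind (v ⊆? S) * sgn ∣ v ∣)
  ind-drop-inside : ∀ v → ind (true ∷ v ⊆? true ∷ S) ≡ ind (v ⊆? S)
  ind-drop-inside v = ind-cong drop-∷-⊆ in⊆in (true ∷ v ⊆? true ∷ S) (v ⊆? S)
  ind-drop-outside : ∀ v → ind (false ∷ v ⊆? true ∷ S) ≡ ind (v ⊆? S)
  ind-drop-outside v = ind-cong drop-∷-⊆ out⊆ (false ∷ v ⊆? true ∷ S) (v ⊆? S)
  negate : ∀ {a b} → a ≡ b → ∀ s → a * (- + 1 * s) ≡ - + 1 * (b * s)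
  negate {a} refl s = commute a s
    where
    commute : ∀ a s → a * (- + 1 * s) ≡ - + 1 * (a * s)
    commute = solve-∀
  cancel : ∀ a → - + 1 * a + a ≡ + 0
  cancel = solve-∀
inclusion–exclusion {ℕ.suc k} (false ∷ S) = begin
  ∑ (allSubsets (ℕ.suc k)) (λ B → ind (B ⊆? false ∷ S) * sgn ∣ B ∣)
    ≡⟨ ∑-allSubsets-suc k (λ B → ind (B ⊆? false ∷ S) * sgn ∣ B ∣) ⟩
  ∑ (allSubsets k) (λ v → ind (true ∷ v ⊆? false ∷ S) * sgn (ℕ.suc ∣ v ∣)) +
  ∑ (allSubsets k) (λ v → ind (false ∷ v ⊆? false ∷ S) * sgn ∣ v ∣)
    ≡⟨ cong₂ _+_ (∑-zero (allSubsets k) (λ v → trans (cong (_* sgn (ℕ.suc ∣ v ∣)) (ind-drop-inside v))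
                                                  (ℤ.*-zeroˡ (sgn (ℕ.suc ∣ v ∣)))))
                 (∑-cong (allSubsets k) (λ v → cong (_* sgn ∣ v ∣) (ind-drop-outside v))) ⟩
  + 0 + ∑ (allSubsets k) (λ v → ind (v ⊆? S) * sgn ∣ v ∣)
    ≡⟨ ℤ.+-identityˡ _ ⟩
  ∑ (allSubsets k) (λ v → ind (v ⊆? S) * sgn ∣ v ∣)
    ≡⟨ inclusion–exclusion S ⟩
  ind (empty? S)
    ≡⟨ ind-cong (λ { empty (zero , ()) ; empty (suc x , there x∈S) → empty (x , x∈S) }) drop-∷-Empty
                (empty? S) (empty? (false ∷ S)) ⟩
  ind (empty? (false ∷ S)) ∎
  where
  open ≡-Reasoning
  ind-drop-inside : ∀ v → ind (true ∷ v ⊆? false ∷ S) ≡ + 0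
  ind-drop-inside v = ind-no (λ ⊆S → case ⊆S here of λ ()) (true ∷ v ⊆? false ∷ S)
  ind-drop-outside : ∀ v → ind (false ∷ v ⊆? false ∷ S) ≡ ind (v ⊆? S)
  ind-drop-outside v = ind-cong drop-∷-⊆ out⊆ (false ∷ v ⊆? false ∷ S) (v ⊆? S)

module _ {A : Set} {P Q : Pred A 0ℓ} (P? : Decidable P) (Q? : Decidable Q) (P⇒Q : ∀ {x} → P x → Q x) where

  count-mono : (xs : List A) → count P? xs ℕ.≤ count Q? xs
  count-mono []       = ℕ.z≤n
  count-mono (x ∷ xs) with P? x | Q? x
  ... | yes _ | yes _ = ℕ.s≤s (count-mono xs)
  ... | yes p | no ¬q = ⊥-elim (¬q (P⇒Q p))
  ... | no  _ | yes _ = ℕ.m≤n⇒m≤1+n (count-mono xs)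
  ... | no  _ | no  _ = count-mono xs

  count-mono-< : ∀ {w} → ¬ P w → Q w → (xs : List A) → w ∈ₗ xs → count P? xs ℕ.< count Q? xs
  count-mono-< ¬pw qw (x ∷ xs) w∈ with P? x | Q? x | w∈
  ... | yes _ | yes _ | there w∈xs = ℕ.s≤s (count-mono-< ¬pw qw xs w∈xs)
  ... | yes p | yes _ | here refl  = ⊥-elim (¬pw p)
  ... | yes p | no ¬q | _          = ⊥-elim (¬q (P⇒Q p))
  ... | no  _ | yes _ | _          = ℕ.s≤s (count-mono xs)
  ... | no  _ | no ¬q | here refl  = ⊥-elim (¬q qw)
  ... | no  _ | no  _ | there w∈xs = count-mono-< ¬pw qw xs w∈xs

disjoint-tail : {k : ℕ} {B : Subset k} {b : Bool} {P : Pred (Subset (ℕ.suc k)) 0ℓ} →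
  (∀ {v x} → P v → x ∈ b ∷ B → x ∉ v) → ∀ {c v x} → P (c ∷ v) → x ∈ B → x ∉ v
disjoint-tail disjoint p x∈B = disjoint p (there x∈B) ∘ there

-- v ↦ (∁ B) ─ v is injective on the subsets v disjoint from B. Instead of counting via
-- injectivity, recurse on B: where B is outside, the map swaps the two halves of the enumeration.
count-≤-via-∁─ : {k : ℕ} (B : Subset k) {P Q : Pred (Subset k) 0ℓ} (P? : Decidable P) (Q? : Decidable Q) →
  (∀ {v x} → P v → x ∈ B → x ∉ v) → (∀ {v} → P v → Q (∁ B ─ v)) →
  count P? (allSubsets k) ℕ.≤ count Q? (allSubsets k)
count-≤-via-∁─ [] P? Q? _ to = count-mono P? Q? (λ { {[]} p → to p }) (allSubsets 0)
count-≤-via-∁─ {ℕ.suc k} (true ∷ B) P? Q? disjoint to = begin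
  count P? (allSubsets (ℕ.suc k))
    ≡⟨ count-allSubsets-suc P? ⟩
  count (P? ∘ (true ∷_)) (allSubsets k) ℕ.+ count (P? ∘ (false ∷_)) (allSubsets k)
    ≡⟨ cong (ℕ._+ count (P? ∘ (false ∷_)) (allSubsets k))
            (count-none (P? ∘ (true ∷_)) (λ p → disjoint p here here) (allSubsets k)) ⟩
  count (P? ∘ (false ∷_)) (allSubsets k)
    ≤⟨ count-≤-via-∁─ B (P? ∘ (false ∷_)) (Q? ∘ (false ∷_)) (disjoint-tail disjoint) to ⟩
  count (Q? ∘ (false ∷_)) (allSubsets k)
    ≤⟨ ℕ.m≤n+m _ _ ⟩
  count (Q? ∘ (true ∷_)) (allSubsets k) ℕ.+ count (Q? ∘ (false ∷_)) (allSubsets k)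
    ≡⟨ count-allSubsets-suc Q? ⟨
  count Q? (allSubsets (ℕ.suc k)) ∎
  where open ℕ.≤-Reasoning
count-≤-via-∁─ {ℕ.suc k} (false ∷ B) P? Q? disjoint to = begin
  count P? (allSubsets (ℕ.suc k))
    ≡⟨ count-allSubsets-suc P? ⟩
  count (P? ∘ (true ∷_)) (allSubsets k) ℕ.+ count (P? ∘ (false ∷_)) (allSubsets k)
    ≤⟨ ℕ.+-mono-≤ (count-≤-via-∁─ B (P? ∘ (true ∷_)) (Q? ∘ (false ∷_)) (disjoint-tail disjoint) to)
                  (count-≤-via-∁─ B (P? ∘ (false ∷_)) (Q? ∘ (true ∷_)) (disjoint-tail disjoint) to) ⟩
  count (Q? ∘ (false ∷_)) (allSubsets k) ℕ.+ count (Q? ∘ (true ∷_)) (allSubsets k)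
    ≡⟨ ℕ.+-comm (count (Q? ∘ (false ∷_)) (allSubsets k)) _ ⟩
  count (Q? ∘ (true ∷_)) (allSubsets k) ℕ.+ count (Q? ∘ (false ∷_)) (allSubsets k)
    ≡⟨ count-allSubsets-suc Q? ⟨
  count Q? (allSubsets (ℕ.suc k)) ∎
  where open ℕ.≤-Reasoning

-- Up-sets of a finite poset

module Upsets {k : ℕ} (P : FinPoset k) where

  _≼_ : Fin k → Fin k → Set
  x ≼ y = T (_≤P_ P x y)

  ∈-MinSet⁻ : ∀ {x} → x ∈ MinSet P → IsMinimal (_≤P_ P) x
  ∈-MinSet⁻ = ∈-tabulate-does⁻ (isMinimal? (_≤P_ P))

  ∈-MinSet⁺ : ∀ {x} → IsMinimal (_≤P_ P) x → x ∈ MinSet P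
  ∈-MinSet⁺ = ∈-tabulate-does⁺ (isMinimal? (_≤P_ P))

  IsUpset : Subset k → Set
  IsUpset U = ∀ x y → x ≼ y → x ∈ U → y ∈ U

  Avoids : Subset k → Subset k → Set
  Avoids B U = ∀ x → x ∈ B → x ∉ U

  UpsetAvoiding : Subset k → Subset k → Set
  UpsetAvoiding B U = IsUpset U × Avoids B U

  isUpset? : ∀ U → Dec (IsUpset U)
  isUpset? U = all? λ x → all? λ y → T? (_≤P_ P x y) →-dec (x ∈? U →-dec y ∈? U)

  upsetAvoiding? : ∀ B U → Dec (UpsetAvoiding B U)
  upsetAvoiding? B U = isUpset? U ×-dec (all? λ x → x ∈? B →-dec ¬? (x ∈? U))

  u : Subset k → ℕ
  u B = count (upsetAvoiding? B) (allSubsets k)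

  -- U ↦ K ∖ B ∖ U exchanges up-sets avoiding B with down-sets of P - B; that the
  -- complement of a down-set is again an up-set uses that B consists of minimal elements.
  dMinus≡u : ∀ {B} → B ⊆ MinSet P → dMinus P B ≡ u B
  dMinus≡u {B} B⊆Min = ℕ.≤-antisym
    (count-≤-via-∁─ B (isDownsetOn? P (∁ B)) (upsetAvoiding? B)
       (λ (D⊆∁B , _) x∈B x∈D → x∈∁p⇒x∉p (D⊆∁B _ x∈D) x∈B) downset→upset)
    (count-≤-via-∁─ B (upsetAvoiding? B) (isDownsetOn? P (∁ B))
       (λ (_ , avoids) → avoids _) upset→downset)
    where
    downset→upset : ∀ {D} → IsDownsetOn P (∁ B) D → UpsetAvoiding B (∁ B ─ D)
    downset→upset {D} (_ , closed) = upset , λ x x∈B x∈ → proj₁ (∈∁─⁻ x∈) x∈B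
      where
      upset : IsUpset (∁ B ─ D)
      upset x y x≼y x∈ with ∈∁─⁻ {B = B} {D} x∈
      ... | x∉B , x∉D = ∈∁─⁺ y∉B y∉D
        where
        y∉B : y ∉ B
        y∉B y∈B = x∉B (subst (_∈ B) (sym (∈-MinSet⁻ (B⊆Min y∈B) x x≼y)) y∈B)
        y∉D : y ∉ D
        y∉D y∈D = x∉D (closed x y (x∉p⇒x∈∁p x∉B) y∈D x≼y)
    upset→downset : ∀ {U} → UpsetAvoiding B U → IsDownsetOn P (∁ B) (∁ B ─ U)
    upset→downset {U} (upset , _) =
      (λ x x∈ → x∉p⇒x∈∁p (proj₁ (∈∁─⁻ x∈))) ,
      λ x y x∈∁B y∈ x≼y → ∈∁─⁺ (x∈∁p⇒x∉p x∈∁B) (proj₂ (∈∁─⁻ y∈) ∘ upset x y x≼y)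

  d≡u⊥ : d P ≡ u ⊥
  d≡u⊥ = trans (cong (dOn P) (sym (∁⊥≡⊤ k))) (dMinus≡u ⊥⊆)

  ⊤-isUpset : IsUpset ⊤
  ⊤-isUpset _ _ _ _ = ∈⊤

  ⊥-upsetAvoiding : ∀ B → UpsetAvoiding B ⊥
  ⊥-upsetAvoiding B = (λ _ _ _ → ⊥-elim ∘ ∉⊥) , λ _ _ → ∉⊥

  u-positive : ∀ B → 0 < u B
  u-positive B = ℕ.≤-<-trans ℕ.z≤n
    (count-mono-< (λ _ → no id) (upsetAvoiding? B) (λ ()) id (⊥-upsetAvoiding B) (allSubsets k) (∈-allSubsets ⊥))

  upsetAvoiding-⊥ : ∀ {B U} → UpsetAvoiding B U → UpsetAvoiding ⊥ U
  upsetAvoiding-⊥ (upset , _) = upset , λ _ → ⊥-elim ∘ ∉⊥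

  u≤u⊥ : ∀ B → u B ℕ.≤ u ⊥
  u≤u⊥ B = count-mono (upsetAvoiding? B) (upsetAvoiding? ⊥) upsetAvoiding-⊥ (allSubsets k)

  u<u⊥ : ∀ {B x} → x ∈ B → u B < u ⊥
  u<u⊥ {B} x∈B = count-mono-< (upsetAvoiding? B) (upsetAvoiding? ⊥) upsetAvoiding-⊥
    (λ (_ , avoids) → avoids _ x∈B ∈⊤) (⊤-isUpset , λ _ → ⊥-elim ∘ ∉⊥) (allSubsets k) (∈-allSubsets ⊤)

  ≼-isPartialOrder : IsPartialOrder′ _≡_ _≼_
  ≼-isPartialOrder = record
    { isPreorder = record
      { isEquivalence = isEquivalence
      ; reflexive     = λ { {x} refl → reflexive x }
      ; trans         = λ {x} {y} {z} → transitive x y z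
      }
    ; antisym = λ {x} {y} → antisymmetric x y
    }
    where
    reflexive = proj₁ (isPO P)
    antisymmetric = proj₁ (proj₂ (isPO P))
    transitive = proj₂ (proj₂ (isPO P))

  minimal-below : ∀ x → ∃[ y ] IsMinimal (_≤P_ P) y × y ≼ x
  minimal-below x = go x (po-wellFounded ≼-isPartialOrder x)
    where
    go : ∀ x → Acc (ToStrict._<_ _≡_ _≼_) x → ∃[ y ] IsMinimal (_≤P_ P) y × y ≼ x
    go x (acc below) with isMinimal? (_≤P_ P) x
    ... | yes x-min = x , x-min , proj₁ (isPO P) x
    ... | no ¬x-min with ¬∀⟶∃¬ k _ (λ y → T? (_≤P_ P y x) →-dec (y ≟ x)) ¬x-min
    ... | y , ¬[y≼x⇒y≡x] with T? (_≤P_ P y x)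
    ...   | no  y⋠x = ⊥-elim (¬[y≼x⇒y≡x] (⊥-elim ∘ y⋠x))
    ...   | yes y≼x =
      let z , z-min , z≼y = go y (below (y≼x , ¬[y≼x⇒y≡x] ∘ const))
      in z , z-min , proj₂ (proj₂ (isPO P)) z y x z≼y y≼x

-- Extensions of P by m new minimal elements

data Split (m k : ℕ) : Fin (m ℕ.+ k) → Set where
  new : (a : Fin m) → Split m k (a ↑ˡ k)
  old : (x : Fin k) → Split m k (m ↑ʳ x)

split : ∀ m {k} i → Split m k i
split ℕ.zero    i       = old i
split (ℕ.suc m) zero    = new zero
split (ℕ.suc m) (suc i) with split m i
... | new a = new (suc a)
... | old x = old x

↑ˡ≢↑ʳ : ∀ {m k} (a : Fin m) (x : Fin k) → a ↑ˡ k ≢ m ↑ʳ x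
↑ˡ≢↑ʳ zero    x ()
↑ˡ≢↑ʳ (suc a) x eq = ↑ˡ≢↑ʳ a x (Fin.suc-injective eq)

δ : ∀ {m} → Fin m → Fin m → Bool
δ a a′ = does (a ≟ a′)

module Extensions {k : ℕ} (P : FinPoset k) (m : ℕ) where
  open Upsets P

  N : ℕ
  N = m ℕ.+ k

  Row : Set
  Row = Fin N → Bool

  NewRow : Subset k → Fin m → Row → Set
  NewRow B a row = (∀ a′ → row (a′ ↑ˡ k) ≡ δ a a′) × UpsetAvoiding B (tabulate (row ∘ (m ↑ʳ_)))

  OldRow : Fin k → Row → Set
  OldRow x row = (∀ a → row (a ↑ˡ k) ≡ false) × (∀ y → row (m ↑ʳ y) ≡ _≤P_ P x y)

  OldRows : (Fin k → Row) → Set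
  OldRows rows = ∀ x → OldRow x (rows x)

  -- Base ⊥ holds in every extension; Base B is the term of the inclusion–exclusion indexed by B.
  Base : Subset k → Rel N → Set
  Base B Q = (∀ a → NewRow B a (Q (a ↑ˡ k))) × OldRows (Q ∘ (m ↑ʳ_))

  newRow? : ∀ B a row → Dec (NewRow B a row)
  newRow? B a row = all? (λ a′ → row (a′ ↑ˡ k) Bool.≟ δ a a′) ×-dec upsetAvoiding? B _

  oldRow? : ∀ x row → Dec (OldRow x row)
  oldRow? x row = all? (λ a → row (a ↑ˡ k) Bool.≟ false) ×-dec all? (λ y → row (m ↑ʳ y) Bool.≟ _≤P_ P x y)

  oldRows? : ∀ rows → Dec (OldRows rows)
  oldRows? rows = all? (λ x → oldRow? x (rows x))

  base? : ∀ B Q → Dec (Base B Q)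
  base? B Q = all? (λ a → newRow? B a (Q (a ↑ˡ k))) ×-dec oldRows? (Q ∘ (m ↑ʳ_))

  Uncovered : Rel N → Fin k → Set
  Uncovered Q x = IsMinimal (_≤P_ P) x × (∀ a → Q (a ↑ˡ k) (m ↑ʳ x) ≡ false)

  uncovered? : ∀ Q x → Dec (Uncovered Q x)
  uncovered? Q x = isMinimal? (_≤P_ P) x ×-dec all? (λ a → Q (a ↑ˡ k) (m ↑ʳ x) Bool.≟ false)

  uncoveredSet : Rel N → Subset k
  uncoveredSet Q = tabulate (λ x → does (uncovered? Q x))

  module _ {B : Subset k} {Q : Rel N} (base : Base B Q) where

    private
      newRows = proj₁ base
      oldRows = proj₂ base
      Q-new-new : ∀ a a′ → Q (a ↑ˡ k) (a′ ↑ˡ k) ≡ δ a a′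
      Q-new-new a = proj₁ (newRows a)
      Q-old-new : ∀ x a → Q (m ↑ʳ x) (a ↑ˡ k) ≡ false
      Q-old-new x = proj₁ (oldRows x)
      Q-old-old : ∀ x y → Q (m ↑ʳ x) (m ↑ʳ y) ≡ _≤P_ P x y
      Q-old-old x = proj₂ (oldRows x)
      ≼-reflexive = proj₁ (isPO P)
      ≼-antisymmetric = proj₁ (proj₂ (isPO P))
      ≼-transitive = proj₂ (proj₂ (isPO P))
      new≤new⇒≡ : ∀ {a a′} → T (Q (a ↑ˡ k) (a′ ↑ˡ k)) → a ≡ a′
      new≤new⇒≡ {a} {a′} a≤a′ with a ≟ a′ | Q-new-new a a′
      ... | yes a≡a′ | _  = a≡a′
      ... | no  _    | eq = ⊥-elim (subst T eq a≤a′)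
      old≰new : ∀ {x a} → ¬ T (Q (m ↑ʳ x) (a ↑ˡ k))
      old≰new {x} {a} = subst T (Q-old-new x a)

    base⇒new-minimal : ∀ a → IsMinimal Q (a ↑ˡ k)
    base⇒new-minimal a i i≤a with split m i
    ... | new a′ = cong (_↑ˡ k) (new≤new⇒≡ i≤a)
    ... | old x  = ⊥-elim (old≰new i≤a)

    base⇒isPartialOrder : IsPartialOrder Q
    base⇒isPartialOrder = reflexive , antisymmetric , transitive
      where
      reflexive : ∀ i → T (Q i i)
      reflexive i with split m i
      ... | new a = subst T (sym (trans (Q-new-new a a) (dec-true (a ≟ a) refl))) _
      ... | old x = subst T (sym (Q-old-old x x)) (≼-reflexive x)
      antisymmetric : ∀ i j → T (Q i j) → T (Q j i) → i ≡ j
      antisymmetric i j i≤j j≤i with split m i | split m j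
      ... | new a | new a′ = cong (_↑ˡ k) (new≤new⇒≡ i≤j)
      ... | new a | old x  = ⊥-elim (old≰new j≤i)
      ... | old x | new a  = ⊥-elim (old≰new i≤j)
      ... | old x | old y  = cong (m ↑ʳ_)
        (≼-antisymmetric x y (subst T (Q-old-old x y) i≤j) (subst T (Q-old-old y x) j≤i))
      transitive : ∀ i j l → T (Q i j) → T (Q j l) → T (Q i l)
      transitive i j l i≤j j≤l with split m i | split m j | split m l
      ... | new a | new a′ | _ with refl ← new≤new⇒≡ i≤j = j≤l
      ... | new a | old x  | new a′ = ⊥-elim (old≰new j≤l)
      ... | new a | old x  | old y  = ∈-tabulate⁻-T (proj₁ (proj₂ (newRows a)) x y
                                        (subst T (Q-old-old x y) j≤l) (∈-tabulate⁺-T i≤j))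
      ... | old x | new a  | _      = ⊥-elim (old≰new i≤j)
      ... | old x | old y  | new a  = ⊥-elim (old≰new j≤l)
      ... | old x | old y  | old z  = subst T (sym (Q-old-old x z))
        (≼-transitive x y z (subst T (Q-old-old x y) i≤j) (subst T (Q-old-old y z) j≤l))

  module _ {Q : Rel N} (oldRows : OldRows (Q ∘ (m ↑ʳ_))) where

    Q-old-old : ∀ x y → Q (m ↑ʳ x) (m ↑ʳ y) ≡ _≤P_ P x y
    Q-old-old x = proj₂ (oldRows x)

    uncovered⇒minimal : ∀ {x} → Uncovered Q x → IsMinimal Q (m ↑ʳ x)
    uncovered⇒minimal {x} (x-min , x-uncovered) i i≤x with split m i
    ... | new a = ⊥-elim (subst T (x-uncovered a) i≤x)
    ... | old y = cong (m ↑ʳ_) (x-min y (subst T (Q-old-old y x) i≤x))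

    minimal⇒uncovered : ∀ {x} → IsMinimal Q (m ↑ʳ x) → Uncovered Q x
    minimal⇒uncovered {x} x-min =
      (λ y y≼x → Fin.↑ʳ-injective m y x (x-min (m ↑ʳ y) (subst T (sym (Q-old-old y x)) y≼x))) ,
      (λ a → ¬T⇒≡false (λ a≤x → ↑ˡ≢↑ʳ a x (x-min (a ↑ˡ k) a≤x)))

  isExtension⇔base : ∀ Q → IsExtension m P Q ⇔ (Base ⊥ Q × Empty (uncoveredSet Q))
  isExtension⇔base Q = mk⇔ to from
    where
    to : IsExtension m P Q → Base ⊥ Q × Empty (uncoveredSet Q)
    to ((reflexive , _ , transitive) , old-old , new-min , old-nonmin) =
      ((λ a → new-new a , (new-old-upset a , λ _ → ⊥-elim ∘ ∉⊥)) , oldRows) ,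
      λ (x , x∈) → old-nonmin x (uncovered⇒minimal {Q = Q} oldRows (∈-tabulate-does⁻ (uncovered? Q) x∈))
      where
      new-new : ∀ a a′ → Q (a ↑ˡ k) (a′ ↑ˡ k) ≡ δ a a′
      new-new a a′ with a ≟ a′
      ... | yes refl = T⇒≡true (reflexive _)
      ... | no  a≢a′ = ¬T⇒≡false (a≢a′ ∘ Fin.↑ˡ-injective k a a′ ∘ new-min a′ (a ↑ˡ k))
      new-old-upset : ∀ a → IsUpset (tabulate (Q (a ↑ˡ k) ∘ (m ↑ʳ_)))
      new-old-upset a x y x≼y x∈ = ∈-tabulate⁺-T (transitive _ _ _
        (∈-tabulate⁻-T x∈) (subst T (sym (old-old x y)) x≼y))
      oldRows : OldRows (Q ∘ (m ↑ʳ_))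
      oldRows x = (λ a → ¬T⇒≡false (λ x≤a → ↑ˡ≢↑ʳ a x (sym (new-min a (m ↑ʳ x) x≤a)))) , old-old x
    from : Base ⊥ Q × Empty (uncoveredSet Q) → IsExtension m P Q
    from (base@(_ , oldRows) , none-uncovered) =
      base⇒isPartialOrder {Q = Q} base , Q-old-old {Q = Q} oldRows , base⇒new-minimal {Q = Q} base ,
      λ x x-min → none-uncovered (x , ∈-tabulate-does⁺ (uncovered? Q) (minimal⇒uncovered {Q = Q} oldRows x-min))

  ∑-single-value : ∀ b → ∑ Bools (λ b′ → ind (b′ Bool.≟ b)) ≡ + 1
  ∑-single-value true  = refl
  ∑-single-value false = refl

  ∑-newRow : ∀ B a → ∑ (allFns N Bools) (λ row → ind (newRow? B a row)) ≡ + u B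
  ∑-newRow B a = begin
    ∑ (allFns N Bools) (λ row → ind (newRow? B a row))
      ≡⟨ ∑-allFns-split m k Bools (λ a′ b → b Bool.≟ δ a a′) (upsetAvoiding? B ∘ tabulate) (newRow? B a)
                        (∑-single-value ∘ δ a) ⟩
    (+ 1) ^ m * ∑ (allFns k Bools) (λ g → ind (upsetAvoiding? B (tabulate g)))
      ≡⟨ cong₂ _*_ (ℤ.^-zeroˡ m) (∑-allFns-Bools k (λ U → ind (upsetAvoiding? B U))) ⟩
    + 1 * ∑ (allSubsets k) (λ U → ind (upsetAvoiding? B U))
      ≡⟨ ℤ.*-identityˡ _ ⟩
    ∑ (allSubsets k) (λ U → ind (upsetAvoiding? B U))
      ≡⟨ count≡∑ind (upsetAvoiding? B) (allSubsets k) ⟨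
    + u B ∎
    where open ≡-Reasoning

  ∑-oldRow : ∀ x → ∑ (allFns N Bools) (λ row → ind (oldRow? x row)) ≡ + 1
  ∑-oldRow x = begin
    ∑ (allFns N Bools) (λ row → ind (oldRow? x row))
      ≡⟨ ∑-allFns-split m k Bools (λ _ b → b Bool.≟ false) _ (oldRow? x) (λ _ → refl) ⟩
    (+ 1) ^ m * ∑ (allFns k Bools) (λ g → ind (all? (λ y → g y Bool.≟ _≤P_ P x y)))
      ≡⟨ cong₂ _*_ (ℤ.^-zeroˡ m)
                   (∑-allFns-∀ k Bools (λ y b → b Bool.≟ _≤P_ P x y) _ (∑-single-value ∘ _≤P_ P x)) ⟩
    + 1 * (+ 1) ^ k
      ≡⟨ cong (+ 1 *_) (ℤ.^-zeroˡ k) ⟩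
    + 1 ∎
    where open ≡-Reasoning

  -- A relation satisfying Base B is determined row by row: u(B) choices for each
  -- new element, and one for each old element.
  ∑-base : ∀ B → ∑ (allRels N) (λ Q → ind (base? B Q)) ≡ (+ u B) ^ m
  ∑-base B = begin
    ∑ (allRels N) (λ Q → ind (base? B Q))
      ≡⟨ ∑-allFns-split m k (allFns N Bools) (newRow? B) oldRows? (base? B) (∑-newRow B) ⟩
    (+ u B) ^ m * ∑ (allFns k (allFns N Bools)) (λ rows → ind (oldRows? rows))
      ≡⟨ cong ((+ u B) ^ m *_) (∑-allFns-∀ k (allFns N Bools) oldRow? oldRows? ∑-oldRow) ⟩
    (+ u B) ^ m * (+ 1) ^ k
      ≡⟨ cong ((+ u B) ^ m *_) (ℤ.^-zeroˡ k) ⟩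
    (+ u B) ^ m * + 1
      ≡⟨ ℤ.*-identityʳ _ ⟩
    (+ u B) ^ m ∎
    where open ≡-Reasoning

  base-⊆-uncovered⇔ : ∀ B Q → (Base ⊥ Q × B ⊆ uncoveredSet Q) ⇔ (B ⊆ MinSet P × Base B Q)
  base-⊆-uncovered⇔ B Q = mk⇔
    (λ ((newRows , oldRows) , B⊆uncovered) →
      (∈-MinSet⁺ ∘ proj₁ ∘ uncovered B⊆uncovered) ,
      (λ a → proj₁ (newRows a) , proj₁ (proj₂ (newRows a)) ,
             λ x x∈B → avoid (proj₂ (uncovered B⊆uncovered x∈B) a)) ,
      oldRows)
    (λ (B⊆Min , newRows , oldRows) →
      ((λ a → proj₁ (newRows a) , proj₁ (proj₂ (newRows a)) , λ _ → ⊥-elim ∘ ∉⊥) , oldRows) ,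
      λ x∈B → ∈-tabulate-does⁺ (uncovered? Q)
        (∈-MinSet⁻ (B⊆Min x∈B) , λ a → ¬T⇒≡false (proj₂ (proj₂ (newRows a)) _ x∈B ∘ ∈-tabulate⁺-T)))
    where
    uncovered : B ⊆ uncoveredSet Q → ∀ {x} → x ∈ B → Uncovered Q x
    uncovered B⊆uncovered = ∈-tabulate-does⁻ (uncovered? Q) ∘ B⊆uncovered
    avoid : ∀ {a x} → Q (a ↑ˡ k) (m ↑ʳ x) ≡ false → x ∉ tabulate (Q (a ↑ˡ k) ∘ (m ↑ʳ_))
    avoid a≰x = subst T a≰x ∘ ∈-tabulate⁻-T

  e≡∑-u : + e m P ≡ ∑ (allSubsets k) (λ B → ind (B ⊆? MinSet P) * sgn ∣ B ∣ * (+ u B) ^ m)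
  e≡∑-u = begin
    + e m P
      ≡⟨ count≡∑ind (isExtension? m P) (allRels N) ⟩
    ∑ (allRels N) (λ Q → ind (isExtension? m P Q))
      ≡⟨ ∑-cong (allRels N) (λ Q → ind-× (Equivalence.to (isExtension⇔base Q))
                                          (Equivalence.from (isExtension⇔base Q))
                                          (base? ⊥ Q) (empty? (uncoveredSet Q)) (isExtension? m P Q)) ⟩
    ∑ (allRels N) (λ Q → ind (base? ⊥ Q) * ind (empty? (uncoveredSet Q)))
      ≡⟨ ∑-cong (allRels N) (λ Q → trans (cong (ind (base? ⊥ Q) *_) (sym (inclusion–exclusion (uncoveredSet Q))))
                                         (sym (∑-*ˡ (allSubsets k) (ind (base? ⊥ Q)) _))) ⟩
    ∑ (allRels N) (λ Q → ∑ (allSubsets k) (λ B → ind (base? ⊥ Q) * (ind (B ⊆? uncoveredSet Q) * sgn ∣ B ∣)))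
      ≡⟨ ∑-comm (allRels N) (allSubsets k) _ ⟩
    ∑ (allSubsets k) (λ B → ∑ (allRels N) (λ Q → ind (base? ⊥ Q) * (ind (B ⊆? uncoveredSet Q) * sgn ∣ B ∣)))
      ≡⟨ ∑-cong (allSubsets k) (λ B → trans (∑-cong (allRels N) (regroup B))
                                            (∑-*ˡ (allRels N) (ind (B ⊆? MinSet P) * sgn ∣ B ∣) _)) ⟩
    ∑ (allSubsets k) (λ B → ind (B ⊆? MinSet P) * sgn ∣ B ∣ * ∑ (allRels N) (λ Q → ind (base? B Q)))
      ≡⟨ ∑-cong (allSubsets k) (λ B → cong (ind (B ⊆? MinSet P) * sgn ∣ B ∣ *_) (∑-base B)) ⟩
    ∑ (allSubsets k) (λ B → ind (B ⊆? MinSet P) * sgn ∣ B ∣ * (+ u B) ^ m) ∎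
    where
    open ≡-Reasoning
    regroup : ∀ B Q → ind (base? ⊥ Q) * (ind (B ⊆? uncoveredSet Q) * sgn ∣ B ∣)
                    ≡ ind (B ⊆? MinSet P) * sgn ∣ B ∣ * ind (base? B Q)
    regroup B Q = begin
      ind (base? ⊥ Q) * (ind (B ⊆? uncoveredSet Q) * sgn ∣ B ∣)
        ≡⟨ ℤ.*-assoc (ind (base? ⊥ Q)) _ _ ⟨
      ind (base? ⊥ Q) * ind (B ⊆? uncoveredSet Q) * sgn ∣ B ∣
        ≡⟨ cong (_* sgn ∣ B ∣) (ind-×-⇔ (base-⊆-uncovered⇔ B Q) (base? ⊥ Q) (B ⊆? uncoveredSet Q)
                                                                (B ⊆? MinSet P) (base? B Q)) ⟩
      ind (B ⊆? MinSet P) * ind (base? B Q) * sgn ∣ B ∣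
        ≡⟨ swap (ind (B ⊆? MinSet P)) (ind (base? B Q)) (sgn ∣ B ∣) ⟩
      ind (B ⊆? MinSet P) * sgn ∣ B ∣ * ind (base? B Q) ∎
      where
      swap : ∀ a b c → a * b * c ≡ a * c * b
      swap = solve-∀

module Coefficients {k : ℕ} (P : FinPoset k) where
  open Upsets P

  ind-isBSet : ∀ i j B → ind (isBSet? P i j B)
                       ≡ ind (B ⊆? MinSet P) * (ind (∣ B ∣ ℕ.≟ i) * ind (dMinus P B ℕ.≟ j))
  ind-isBSet i j B =
    trans (ind-× id id pointwise? (size? ×-dec dMinus?) (isBSet? P i j B))
          (cong₂ _*_ (ind-cong (λ B⊆Min {x} → B⊆Min x) (λ B⊆Min x → B⊆Min) pointwise? (B ⊆? MinSet P))
                     (ind-× id id size? dMinus? (size? ×-dec dMinus?)))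
    where
    pointwise? = all? λ x → x ∈? B →-dec x ∈? MinSet P
    size? = ∣ B ∣ ℕ.≟ i
    dMinus? = dMinus P B ℕ.≟ j

  c≡∑ : ∀ j → c j P ≡ ∑ (allSubsets k) (λ B → ind (B ⊆? MinSet P) * sgn ∣ B ∣ * ind (dMinus P B ℕ.≟ j))
  c≡∑ j = begin
    sum0to (mP P) (λ i → sgn i * + b i j P)
      ≡⟨ sum0to-cong (mP P) (λ i → trans (cong (sgn i *_) (count≡∑ind (isBSet? P i j) (allSubsets k)))
                                         (sym (∑-*ˡ (allSubsets k) (sgn i) _))) ⟩
    sum0to (mP P) (λ i → ∑ (allSubsets k) (λ B → sgn i * ind (isBSet? P i j B)))
      ≡⟨ sum0to-∑ (mP P) (allSubsets k) _ ⟩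
    ∑ (allSubsets k) (λ B → sum0to (mP P) (λ i → sgn i * ind (isBSet? P i j B)))
      ≡⟨ ∑-cong (allSubsets k) collapse ⟩
    ∑ (allSubsets k) (λ B → ind (B ⊆? MinSet P) * sgn ∣ B ∣ * ind (dMinus P B ℕ.≟ j)) ∎
    where
    open ≡-Reasoning
    collapse : ∀ B → sum0to (mP P) (λ i → sgn i * ind (isBSet? P i j B))
                   ≡ ind (B ⊆? MinSet P) * sgn ∣ B ∣ * ind (dMinus P B ℕ.≟ j)
    collapse B = begin
      sum0to (mP P) (λ i → sgn i * ind (isBSet? P i j B))
        ≡⟨ sum0to-cong (mP P) (λ i → trans (cong (sgn i *_) (ind-isBSet i j B))
                                           (reorder (sgn i) (ind (B ⊆? MinSet P)) (ind (∣ B ∣ ℕ.≟ i))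
                                                    (ind (dMinus P B ℕ.≟ j)))) ⟩
      sum0to (mP P) (λ i → ind (B ⊆? MinSet P) * (ind (∣ B ∣ ℕ.≟ i) * (sgn i * ind (dMinus P B ℕ.≟ j))))
        ≡⟨ sum0to-*ˡ (mP P) (ind (B ⊆? MinSet P)) _ ⟩
      ind (B ⊆? MinSet P) * sum0to (mP P) (λ i → ind (∣ B ∣ ℕ.≟ i) * (sgn i * ind (dMinus P B ℕ.≟ j)))
        ≡⟨ ind-guard (B ⊆? MinSet P) (λ B⊆Min → sum0to-δ ∣ B ∣ _ (mP P) (p⊆q⇒∣p∣≤∣q∣ B⊆Min)) ⟩
      ind (B ⊆? MinSet P) * (sgn ∣ B ∣ * ind (dMinus P B ℕ.≟ j))
        ≡⟨ ℤ.*-assoc (ind (B ⊆? MinSet P)) _ _ ⟨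
      ind (B ⊆? MinSet P) * sgn ∣ B ∣ * ind (dMinus P B ℕ.≟ j) ∎
      where
      reorder : ∀ s a b c → s * (a * (b * c)) ≡ a * (b * (s * c))
      reorder = solve-∀

  -- The sum over j collapses for each B because d(P - B) = u(B) lies in [1, d(P)].
  ∑-c-pow : ∀ m → sum1to (d P) (λ j → c j P * (+ j) ^ m)
                ≡ ∑ (allSubsets k) (λ B → ind (B ⊆? MinSet P) * sgn ∣ B ∣ * (+ u B) ^ m)
  ∑-c-pow m = begin
    sum1to (d P) (λ j → c j P * (+ j) ^ m)
      ≡⟨ sum1to-cong (d P) (λ j → trans (cong (_* (+ j) ^ m) (c≡∑ j)) (sym (∑-*ʳ (allSubsets k) _ _))) ⟩
    sum1to (d P) (λ j → ∑ (allSubsets k) (λ B → ind (B ⊆? MinSet P) * sgn ∣ B ∣ * ind (dMinus P B ℕ.≟ j) * (+ j) ^ m))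
      ≡⟨ sum1to-∑ (d P) (allSubsets k) _ ⟩
    ∑ (allSubsets k) (λ B → sum1to (d P) (λ j → ind (B ⊆? MinSet P) * sgn ∣ B ∣ * ind (dMinus P B ℕ.≟ j) * (+ j) ^ m))
      ≡⟨ ∑-cong (allSubsets k) collapse ⟩
    ∑ (allSubsets k) (λ B → ind (B ⊆? MinSet P) * sgn ∣ B ∣ * (+ u B) ^ m) ∎
    where
    open ≡-Reasoning
    collapse : ∀ B → sum1to (d P) (λ j → ind (B ⊆? MinSet P) * sgn ∣ B ∣ * ind (dMinus P B ℕ.≟ j) * (+ j) ^ m)
                   ≡ ind (B ⊆? MinSet P) * sgn ∣ B ∣ * (+ u B) ^ m
    collapse B = begin
      sum1to (d P) (λ j → ind (B ⊆? MinSet P) * sgn ∣ B ∣ * ind (dMinus P B ℕ.≟ j) * (+ j) ^ m)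
        ≡⟨ sum1to-cong (d P) (λ j → ℤ.*-assoc (ind (B ⊆? MinSet P) * sgn ∣ B ∣) _ _) ⟩
      sum1to (d P) (λ j → ind (B ⊆? MinSet P) * sgn ∣ B ∣ * (ind (dMinus P B ℕ.≟ j) * (+ j) ^ m))
        ≡⟨ sum1to-*ˡ (d P) (ind (B ⊆? MinSet P) * sgn ∣ B ∣) _ ⟩
      ind (B ⊆? MinSet P) * sgn ∣ B ∣ * sum1to (d P) (λ j → ind (dMinus P B ℕ.≟ j) * (+ j) ^ m)
        ≡⟨ ℤ.*-assoc (ind (B ⊆? MinSet P)) _ _ ⟩
      ind (B ⊆? MinSet P) * (sgn ∣ B ∣ * sum1to (d P) (λ j → ind (dMinus P B ℕ.≟ j) * (+ j) ^ m))
        ≡⟨ ind-guard (B ⊆? MinSet P) (λ B⊆Min → cong (sgn ∣ B ∣ *_) (δ-u B⊆Min)) ⟩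
      ind (B ⊆? MinSet P) * (sgn ∣ B ∣ * (+ u B) ^ m)
        ≡⟨ ℤ.*-assoc (ind (B ⊆? MinSet P)) _ _ ⟨
      ind (B ⊆? MinSet P) * sgn ∣ B ∣ * (+ u B) ^ m ∎
      where
      δ-u : B ⊆ MinSet P → sum1to (d P) (λ j → ind (dMinus P B ℕ.≟ j) * (+ j) ^ m) ≡ (+ u B) ^ m
      δ-u B⊆Min rewrite dMinus≡u B⊆Min =
        sum1to-δ (u B) (λ j → (+ j) ^ m) (d P) (u-positive B) (subst (u B ℕ.≤_) (sym d≡u⊥) (u≤u⊥ B))

  e≡∑c-pow : ∀ m → + e m P ≡ sum1to (d P) (λ j → c j P * (+ j) ^ m)
  e≡∑c-pow m = trans (Extensions.e≡∑-u P m) (sym (∑-c-pow m))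

  -- Only B = ∅ contributes: removing a nonempty set of minimal elements loses the up-set ⊤.
  c-top : c (d P) P ≡ + 1
  c-top = begin
    c (d P) P
      ≡⟨ c≡∑ (d P) ⟩
    ∑ (allSubsets k) (λ B → ind (B ⊆? MinSet P) * sgn ∣ B ∣ * ind (dMinus P B ℕ.≟ d P))
      ≡⟨ ∑-allSubsets-only ⊥ _ vanish ⟩
    ind (⊥ ⊆? MinSet P) * sgn ∣ ⊥ {k} ∣ * ind (dMinus P ⊥ ℕ.≟ d P)
      ≡⟨ cong₂ (λ x y → x * sgn y * ind (dMinus P ⊥ ℕ.≟ d P)) (ind-yes (λ {x} → ⊥⊆) (⊥ ⊆? MinSet P)) (∣⊥∣≡0 k) ⟩
    + 1 * + 1 * ind (dMinus P ⊥ ℕ.≟ d P)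
      ≡⟨ cong (+ 1 * + 1 *_) (ind-yes (trans (dMinus≡u ⊥⊆) (sym d≡u⊥)) (dMinus P ⊥ ℕ.≟ d P)) ⟩
    + 1 ∎
    where
    open ≡-Reasoning
    vanish : ∀ B → B ≢ ⊥ → ind (B ⊆? MinSet P) * sgn ∣ B ∣ * ind (dMinus P B ℕ.≟ d P) ≡ + 0
    vanish B B≢⊥ with B ⊆? MinSet P | nonempty? B
    ... | no  _      | _           = refl
    ... | yes _      | no empty    = ⊥-elim (B≢⊥ (Empty-unique empty))
    ... | yes B⊆Min  | yes (x , x∈B) = trans (cong (+ 1 * sgn ∣ B ∣ *_) (ind-no dMinus≢d (dMinus P B ℕ.≟ d P)))
                                             (ℤ.*-zeroʳ (+ 1 * sgn ∣ B ∣))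
      where
      dMinus≢d : dMinus P B ≢ d P
      dMinus≢d eq = ℕ.<-irrefl (trans (sym (dMinus≡u B⊆Min)) (trans eq d≡u⊥)) (u<u⊥ x∈B)

module SpecialValues {k : ℕ} (P : FinPoset k) where
  open Upsets P

  e-zero : 0 < k → e 0 P ≡ 0
  e-zero 0<k with y , y-min , _ ← minimal-below (fromℕ< 0<k) = ℤ.+-injective (begin
    + e 0 P
      ≡⟨ Extensions.e≡∑-u P 0 ⟩
    ∑ (allSubsets k) (λ B → ind (B ⊆? MinSet P) * sgn ∣ B ∣ * + 1)
      ≡⟨ ∑-cong (allSubsets k) (λ B → ℤ.*-identityʳ _) ⟩
    ∑ (allSubsets k) (λ B → ind (B ⊆? MinSet P) * sgn ∣ B ∣)
      ≡⟨ inclusion–exclusion (MinSet P) ⟩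
    ind (empty? (MinSet P))
      ≡⟨ ind-no (λ empty → empty (y , ∈-MinSet⁺ y-min)) (empty? (MinSet P)) ⟩
    + 0 ∎)
    where open ≡-Reasoning

  ⊆MinSet×upsetAvoiding⇔ : ∀ B U → (B ⊆ MinSet P × UpsetAvoiding B U) ⇔ (IsUpset U × B ⊆ MinSet P ─ U)
  ⊆MinSet×upsetAvoiding⇔ B U = mk⇔
    (λ (B⊆Min , upset , avoids) → upset , λ x∈B → x∈p∧x∉q⇒x∈p─q (B⊆Min x∈B) (avoids _ x∈B))
    (λ (upset , B⊆Min─U) →
      (p─q⊆p (MinSet P) U ∘ B⊆Min─U) , upset , λ _ → x∈p─q⇒x∉q ∘ B⊆Min─U)

  upset-⊇-MinSet⇒≡⊤ : ∀ {U} → IsUpset U → Empty (MinSet P ─ U) → U ≡ ⊤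
  upset-⊇-MinSet⇒≡⊤ {U} upset none = ⊆-antisym ⊆⊤ ⊤⊆U
    where
    ⊤⊆U : ⊤ ⊆ U
    ⊤⊆U {x} _ with y , y-min , y≼x ← minimal-below x with y ∈? U
    ... | yes y∈U = upset y x y≼x y∈U
    ... | no  y∉U = ⊥-elim (none (y , x∈p∧x∉q⇒x∈p─q (∈-MinSet⁺ y-min) y∉U))

  -- Put m = 1 in the formula for e(m,P) and expand u(B) as a sum over up-sets U;
  -- inclusion–exclusion over B ⊆ Min P ∖ U leaves only the up-set ⊤.
  e-one : e 1 P ≡ 1
  e-one = ℤ.+-injective (begin
    + e 1 P
      ≡⟨ Extensions.e≡∑-u P 1 ⟩
    ∑ (allSubsets k) (λ B → ind (B ⊆? MinSet P) * sgn ∣ B ∣ * (+ u B) ^ 1)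
      ≡⟨ ∑-cong (allSubsets k) expand ⟩
    ∑ (allSubsets k) (λ B → ∑ (allSubsets k) (λ U → ind (B ⊆? MinSet P) * sgn ∣ B ∣ * ind (upsetAvoiding? B U)))
      ≡⟨ ∑-comm (allSubsets k) (allSubsets k) _ ⟩
    ∑ (allSubsets k) (λ U → ∑ (allSubsets k) (λ B → ind (B ⊆? MinSet P) * sgn ∣ B ∣ * ind (upsetAvoiding? B U)))
      ≡⟨ ∑-cong (allSubsets k) exclude ⟩
    ∑ (allSubsets k) (λ U → ind (isUpset? U) * ind (empty? (MinSet P ─ U)))
      ≡⟨ ∑-allSubsets-only ⊤ _ vanish ⟩
    ind (isUpset? ⊤) * ind (empty? (MinSet P ─ ⊤))
      ≡⟨ cong₂ _*_ (ind-yes ⊤-isUpset (isUpset? ⊤))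
                   (ind-yes (λ (x , x∈) → x∈p─q⇒x∉q x∈ ∈⊤) (empty? (MinSet P ─ ⊤))) ⟩
    + 1 ∎)
    where
    open ≡-Reasoning
    expand : ∀ B → ind (B ⊆? MinSet P) * sgn ∣ B ∣ * (+ u B) ^ 1
                 ≡ ∑ (allSubsets k) (λ U → ind (B ⊆? MinSet P) * sgn ∣ B ∣ * ind (upsetAvoiding? B U))
    expand B = trans (cong (ind (B ⊆? MinSet P) * sgn ∣ B ∣ *_)
                           (trans (ℤ.^-identityʳ (+ u B)) (count≡∑ind (upsetAvoiding? B) (allSubsets k))))
                     (sym (∑-*ˡ (allSubsets k) (ind (B ⊆? MinSet P) * sgn ∣ B ∣) _))
    exclude : ∀ U → ∑ (allSubsets k) (λ B → ind (B ⊆? MinSet P) * sgn ∣ B ∣ * ind (upsetAvoiding? B U))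
                  ≡ ind (isUpset? U) * ind (empty? (MinSet P ─ U))
    exclude U = begin
      ∑ (allSubsets k) (λ B → ind (B ⊆? MinSet P) * sgn ∣ B ∣ * ind (upsetAvoiding? B U))
        ≡⟨ ∑-cong (allSubsets k) regroup ⟩
      ∑ (allSubsets k) (λ B → ind (isUpset? U) * (ind (B ⊆? MinSet P ─ U) * sgn ∣ B ∣))
        ≡⟨ ∑-*ˡ (allSubsets k) (ind (isUpset? U)) _ ⟩
      ind (isUpset? U) * ∑ (allSubsets k) (λ B → ind (B ⊆? MinSet P ─ U) * sgn ∣ B ∣)
        ≡⟨ cong (ind (isUpset? U) *_) (inclusion–exclusion (MinSet P ─ U)) ⟩
      ind (isUpset? U) * ind (empty? (MinSet P ─ U)) ∎
      where
      regroup : ∀ B → ind (B ⊆? MinSet P) * sgn ∣ B ∣ * ind (upsetAvoiding? B U)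
                    ≡ ind (isUpset? U) * (ind (B ⊆? MinSet P ─ U) * sgn ∣ B ∣)
      regroup B = begin
        ind (B ⊆? MinSet P) * sgn ∣ B ∣ * ind (upsetAvoiding? B U)
          ≡⟨ swap (ind (B ⊆? MinSet P)) (sgn ∣ B ∣) (ind (upsetAvoiding? B U)) ⟩
        ind (B ⊆? MinSet P) * ind (upsetAvoiding? B U) * sgn ∣ B ∣
          ≡⟨ cong (_* sgn ∣ B ∣) (ind-×-⇔ (⊆MinSet×upsetAvoiding⇔ B U) (B ⊆? MinSet P) (upsetAvoiding? B U)
                                                                      (isUpset? U) (B ⊆? MinSet P ─ U)) ⟩
        ind (isUpset? U) * ind (B ⊆? MinSet P ─ U) * sgn ∣ B ∣
          ≡⟨ ℤ.*-assoc (ind (isUpset? U)) _ _ ⟩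
        ind (isUpset? U) * (ind (B ⊆? MinSet P ─ U) * sgn ∣ B ∣) ∎
        where
        swap : ∀ a b c → a * b * c ≡ a * c * b
        swap = solve-∀
    vanish : ∀ U → U ≢ ⊤ → ind (isUpset? U) * ind (empty? (MinSet P ─ U)) ≡ + 0
    vanish U U≢⊤ with isUpset? U | empty? (MinSet P ─ U)
    ... | yes upset | yes none = ⊥-elim (U≢⊤ (upset-⊇-MinSet⇒≡⊤ upset none))
    ... | yes _     | no  _    = refl
    ... | no  _     | _        = refl

theorem4p3 : {k : ℕ} (P : FinPoset k) →
    ((m : ℕ) → + e m P ≡ sum1to (d P) (λ j → c j P * (+ j) ^ m)) ×
    (c (d P) P ≡ + 1) ×
    (0 < k → (sum1to (d P) (λ j → c j P) ≡ + e 0 P) × (e 0 P ≡ 0)) ×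
    (sum1to (d P) (λ j → c j P * (+ j)) ≡ + e 1 P) × (e 1 P ≡ 1)
theorem4p3 P = e≡∑c-pow , c-top , (λ 0<k → ∑c≡e0 , e-zero 0<k) , ∑cj≡e1 , e-one
  where
  open Coefficients P
  open SpecialValues P
  ∑c≡e0 : sum1to (d P) (λ j → c j P) ≡ + e 0 P
  ∑c≡e0 = trans (sum1to-cong (d P) (λ j → sym (ℤ.*-identityʳ (c j P)))) (sym (e≡∑c-pow 0))
  ∑cj≡e1 : sum1to (d P) (λ j → c j P * + j) ≡ + e 1 P
  ∑cj≡e1 = trans (sum1to-cong (d P) (λ j → cong (c j P *_) (sym (ℤ.^-identityʳ (+ j))))) (sym (e≡∑c-pow 1))
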